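{- Let $(G_1,T_1)$ and $(G_2,T_2)$ be vertex-disjoint graphs with terminals and let $d$ be a positive integer. For each $i\in\{1,2\}$, suppose that $|T_i|\geq 2$, that $T_i$ is $d$-edge-connected in $G_i$, and let $t_i\in T_i$ be a terminal of degree $d$ in $G_i$. Let $h:\partial_{G_1}(t_1)\to\partial_{G_2}(t_2)$ be a bijection, and let $(G,T)=G_1\circ_h G_2$ be the insertion of $G_2$ into $G_1$ via $h$. Then $T$ is $d$-edge-connected in $G$.
   Context: Graphs are finite and may have parallel edges. A graph with terminals is a pair $(G,T)$ with $T\subseteq V(G)$. The set $T$ is $d$-edge-connected in $G$ if $G$ has no edge-cut of size smaller than $d$ separating two vertices of $T$ (no assumption on the connectivity of $G$ itself). For $X\subseteq V(G)$, $\partial_G(X)$ denotes the set of edges of $G$ with exactly one endvertex in $X$, and $\partial_G(v)=\partial_G(\{v\})$. Insertion: given disjoint graphs with terminals $(G_1,T_1)$, $(G_2,T_2)$, terminals $t_1\in T_1$, $t_2\in T_2$ of equal degree, and a bijection $h:\partial_{G_1}(t_1)\to\partial_{G_2}(t_2)$, the graph with terminals $G_1\circ_h G_2$ is obtained by taking the disjoint union of $G_1-t_1$ and $G_2-t_2$, then for each $e\in\partial_{G_1}(t_1)$ adding an edge joining the endvertex of $e$ other than $t_1$ to the endvertex of $h(e)$ other than $t_2$; its terminal set is $(T_1\cup T_2)\setminus\{t_1,t_2\}$. -}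

module Defs where

open import Data.Nat using (ℕ; zero; suc; _+_; _≤_)
open import Data.Bool using (Bool; true; false; if_then_else_; not; _xor_; T)
open import Data.Bool.Properties using (T?)
open import Data.Fin using (Fin; punchOut; punchIn; _↑ˡ_; _↑ʳ_; splitAt; _≟_)
open import Data.Fin.Properties using ()
open import Data.List using (List; []; _∷_; length; lookup; map; mapMaybe; _++_; allFin)
open import Data.Nat.ListAction using (sum)
open import Data.Maybe using (Maybe; just; nothing)
open import Data.Product using (Σ; _×_; _,_; proj₁; proj₂)
open import Data.Sum using ([_,_])
open import Function using (_∘_)
open import Function.Bundles using (Bijection)
open import Relation.Nullary using (yes; no)
open import Relation.Nullary.Decidable using (⌊_⌋)

-- Parallel edges = repeated
-- entries; loops (u , u) are allowed.  Edges are identified by their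
-- position in the list, i.e. the edge set is Fin (length E).
Graph : ℕ → Set
Graph n = List (Fin n × Fin n)

Edge : ∀ {n} → Graph n → Set
Edge G = Fin (length G)

ends : ∀ {n} (G : Graph n) → Edge G → Fin n × Fin n
ends G e = lookup G e

VSet : ℕ → Set
VSet n = Fin n → Bool

count : ∀ {A : Set} → (A → Bool) → List A → ℕ
count p xs = sum (map (λ x → if p x then 1 else 0) xs)

card : ∀ {n} → VSet n → ℕ
card X = count X (allFin _)

cutSize : ∀ {n} → Graph n → VSet n → ℕ
cutSize G X = count (λ uv → X (proj₁ uv) xor X (proj₂ uv)) G

-- degree of v (each loop counts twice)
eqb : ∀ {n} → Fin n → Fin n → Bool
eqb u v = ⌊ u ≟ v ⌋

degree : ∀ {n} → Graph n → Fin n → ℕ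
degree G v = sum (map (λ uv → (if eqb (proj₁ uv) v then 1 else 0)
                            + (if eqb (proj₂ uv) v then 1 else 0)) G)

EdgeConnected : ∀ {n} → ℕ → Graph n → VSet n → Set
EdgeConnected d G Tm =
  ∀ (X : VSet _) (s t : Fin _) → T (Tm s) → T (Tm t) →
    T (X s) → T (not (X t)) → d ≤ cutSize G X

isBd : ∀ {n} → Fin n → Fin n → Fin n → Bool
isBd t u v with t ≟ u | t ≟ v
... | yes _ | yes _ = false
... | yes _ | no  _ = true
... | no  _ | yes _ = true
... | no  _ | no  _ = false

Bd : ∀ {n} → Graph n → Fin n → Set
Bd G t = Σ (Edge G) λ e → T (isBd t (proj₁ (ends G e)) (proj₂ (ends G e)))

-- the endvertex (other than t) of an edge of ∂(t), as a vertex of G - t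
-- (vertices of G - t are Fin k, embedded into Fin (suc k) by punchIn t)
otherEnd : ∀ {k} (t u v : Fin (suc k)) → T (isBd t u v) → Fin k
otherEnd t u v p with t ≟ u | t ≟ v
otherEnd t u v () | yes _ | yes _
otherEnd t u v p  | yes _ | no t≢v = punchOut t≢v
otherEnd t u v p  | no t≢u | yes _ = punchOut t≢u
otherEnd t u v () | no _ | no _

otherEndBd : ∀ {k} (G : Graph (suc k)) (t : Fin (suc k)) → Bd G t → Fin k
otherEndBd G t (e , p) = otherEnd t (proj₁ (ends G e)) (proj₂ (ends G e)) p

bdElem : ∀ {n} (G : Graph n) (t : Fin n) → Edge G → Maybe (Bd G t)
bdElem G t e with T? (isBd t (proj₁ (ends G e)) (proj₂ (ends G e)))
... | yes p = just (e , p)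
... | no  _ = nothing

bdList : ∀ {n} (G : Graph n) (t : Fin n) → List (Bd G t)
bdList G t = mapMaybe (bdElem G t) (allFin _)

dropV : ∀ {k} (t : Fin (suc k)) → Fin (suc k) → Maybe (Fin k)
dropV t u with t ≟ u
... | yes _   = nothing
... | no t≢u  = just (punchOut t≢u)

keepEdge : ∀ {k m} (t : Fin (suc k)) (f : Fin k → Fin m) →
           Fin (suc k) × Fin (suc k) → Maybe (Fin m × Fin m)
keepEdge t f (u , v) with dropV t u | dropV t v
... | just u' | just v' = just (f u' , f v')
... | _       | _       = nothing

-- Insertion G₁ ∘_h G₂.  Vertex set: V(G₁ - t₁) ⊎ V(G₂ - t₂) = Fin (k₁ + k₂)
-- (first k₁ vertices from G₁, the rest from G₂).
insertG : ∀ {k₁ k₂} (G₁ : Graph (suc k₁)) (G₂ : Graph (suc k₂))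
          (t₁ : Fin (suc k₁)) (t₂ : Fin (suc k₂)) →
          (Bd G₁ t₁ → Bd G₂ t₂) → Graph (k₁ + k₂)
insertG {k₁} {k₂} G₁ G₂ t₁ t₂ h =
     mapMaybe (keepEdge t₁ (_↑ˡ k₂)) G₁
  ++ mapMaybe (keepEdge t₂ (k₁ ↑ʳ_)) G₂
  ++ map (λ e → (otherEndBd G₁ t₁ e ↑ˡ k₂ , k₁ ↑ʳ otherEndBd G₂ t₂ (h e)))
         (bdList G₁ t₁)

insertT : ∀ {k₁ k₂} → VSet (suc k₁) → VSet (suc k₂) →
          Fin (suc k₁) → Fin (suc k₂) → VSet (k₁ + k₂)
insertT {k₁} T₁ T₂ t₁ t₂ x =
  [ T₁ ∘ punchIn t₁ , T₂ ∘ punchIn t₂ ] (splitAt k₁ x)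

module Submission where

-- Let X separate two terminals of G = G₁ ∘ₕ G₂, and split its cut into the c₁ edges inside G₁ - t₁, the
-- c₂ edges inside G₂ - t₂ and the C new edges.  Extending X to G₁ by putting t₁ on side β gives a cut of
-- G₁ of size c₁ + M₁ β, where M₁ β counts the edges of ∂(t₁) whose other end is not on side β; likewise
-- for G₂, transported along h.  Since |∂(t₁)| = d (it lies between the edge-connectivity and the degree
-- of t₁), M₁ β + M₁ (¬ β) = d, so a bound d ≤ c₁ + M₁ (¬ β) coming from d-edge-connectivity of T₁
-- yields M₁ β ≤ c₁.
-- If both terminals lie in G₁ - t₁, put t₂ opposite to a second terminal of G₂, on side ρ say; this
-- gives M₂ ρ ≤ c₂, hence d ≤ c₁ + M₁ ρ ≤ c₁ + M₂ ρ + C ≤ c₁ + c₂ + C by the triangle inequality for sides.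
-- If they lie on different sides, separating each from its tᵢ gives M₁ β ≤ c₁ and M₂ (¬ β) ≤ c₂, and
-- each of the d new edges is counted by M₁ β, M₂ (¬ β) or C.

open import Defs
open import Algebra.Properties.CommutativeSemigroup using (interchange; x∙yz≈y∙xz)
open import Data.Nat using (ℕ; suc; _+_; _*_; _≤_; z≤n; s≤s)
open import Data.Nat.Properties
  using (≤-refl; ≤-trans; ≤-reflexive; ≤-antisym; +-comm; +-identityʳ; *-identityʳ; *-zeroʳ; *-distribˡ-+;
         +-mono-≤; +-monoˡ-≤; +-monoʳ-≤; +-cancelʳ-≤; +-commutativeSemigroup; module ≤-Reasoning)
open import Data.Bool using (Bool; true; false; if_then_else_; not; _xor_; T)
open import Data.Fin using (Fin; zero; suc; _≟_; punchIn; punchOut; _↑ˡ_; _↑ʳ_; splitAt)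
open import Data.Fin.Properties
  using (punchOut-cong; punchOut-punchIn; punchInᵢ≢i; punchIn-punchOut; any?; splitAt-↑ˡ; splitAt-↑ʳ; splitAt⁻¹-↑ˡ; splitAt⁻¹-↑ʳ)
open import Data.Bool.Properties using (T?; T-irrelevant; not-involutive; xor-comm; xor-same)
open import Data.Product using (∃; _×_; _,_; proj₁; proj₂)
open import Function.Bundles using (_⤖_; Bijection; Surjection)
open import Relation.Binary.Definitions using (DecidableEquality)
open import Data.List using (List; []; _∷_; length; lookup; map; mapMaybe; _++_; allFin)
open import Data.List.Properties using (map-cong; map-++; map-tabulate)
open import Data.Nat.ListAction using (sum)
open import Data.Nat.ListAction.Properties using (sum-++)
open import Data.Maybe using (Maybe; just; nothing; maybe)
open import Data.Sum using (inj₁; inj₂; [_,_])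
open import Function using (_∘_; id)
open import Relation.Nullary using (yes; no; ¬_; contradiction)
open import Relation.Nullary.Decidable using (⌊_⌋)
open import Relation.Binary.PropositionalEquality using (_≡_; refl; sym; trans; cong; cong₂; subst; module ≡-Reasoning)

private variable
  A B : Set

-- With these, count p xs and cutSize G X unfold definitionally to sums ∑ xs (ι ∘ p).
ι : Bool → ℕ
ι b = if b then 1 else 0

∑ : List A → (A → ℕ) → ℕ
∑ xs f = sum (map f xs)

∑-cong : ∀ (xs : List A) {f g : A → ℕ} → (∀ x → f x ≡ g x) → ∑ xs f ≡ ∑ xs g
∑-cong xs f≗g = cong sum (map-cong f≗g xs)

∑-mono : ∀ (xs : List A) {f g : A → ℕ} → (∀ x → f x ≤ g x) → ∑ xs f ≤ ∑ xs g
∑-mono []       f≤g = z≤n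
∑-mono (x ∷ xs) f≤g = +-mono-≤ (f≤g x) (∑-mono xs f≤g)

∑-+ : ∀ (xs : List A) (f g : A → ℕ) → ∑ xs (λ x → f x + g x) ≡ ∑ xs f + ∑ xs g
∑-+ []       f g = refl
∑-+ (x ∷ xs) f g = trans (cong (f x + g x +_) (∑-+ xs f g))
                        (interchange +-commutativeSemigroup (f x) (g x) (∑ xs f) (∑ xs g))

∑-*ˡ : ∀ (xs : List A) (c : ℕ) (f : A → ℕ) → ∑ xs (λ x → c * f x) ≡ c * ∑ xs f
∑-*ˡ []       c f = sym (*-zeroʳ c)
∑-*ˡ (x ∷ xs) c f = trans (cong (c * f x +_) (∑-*ˡ xs c f)) (sym (*-distribˡ-+ c (f x) (∑ xs f)))

∑-zero : ∀ (xs : List A) → ∑ xs (λ _ → 0) ≡ 0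
∑-zero []       = refl
∑-zero (x ∷ xs) = ∑-zero xs

∑-one : ∀ (xs : List A) → ∑ xs (λ _ → 1) ≡ length xs
∑-one []       = refl
∑-one (x ∷ xs) = cong suc (∑-one xs)

∑-++ : ∀ (xs ys : List A) (f : A → ℕ) → ∑ (xs ++ ys) f ≡ ∑ xs f + ∑ ys f
∑-++ xs ys f = trans (cong sum (map-++ f xs ys)) (sum-++ (map f xs) (map f ys))

∑-swap : (xs : List A) (ys : List B) (F : A → B → ℕ) →
         ∑ xs (λ x → ∑ ys (F x)) ≡ ∑ ys (λ y → ∑ xs (λ x → F x y))
∑-swap []       ys F = sym (∑-zero ys)
∑-swap (x ∷ xs) ys F = trans (cong (∑ ys (F x) +_) (∑-swap xs ys F))
                            (sym (∑-+ ys (F x) (λ y → ∑ xs (λ x → F x y))))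

∑-map : (xs : List A) (g : A → B) (f : B → ℕ) → ∑ (map g xs) f ≡ ∑ xs (f ∘ g)
∑-map []       g f = refl
∑-map (x ∷ xs) g f = cong (f (g x) +_) (∑-map xs g f)

∑-mapMaybe : (xs : List A) (g : A → Maybe B) (f : B → ℕ) →
             ∑ (mapMaybe g xs) f ≡ ∑ xs (maybe f 0 ∘ g)
∑-mapMaybe []       g f = refl
∑-mapMaybe (x ∷ xs) g f with g x
... | just y  = cong (f y +_) (∑-mapMaybe xs g f)
... | nothing = ∑-mapMaybe xs g f

∑-allFin-suc : ∀ n (f : Fin (suc n) → ℕ) → ∑ (allFin (suc n)) f ≡ f zero + ∑ (allFin n) (f ∘ suc)
∑-allFin-suc n f = cong (f zero +_) (cong sum (trans (map-tabulate suc f) (sym (map-tabulate id (f ∘ suc)))))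

∑-lookup : (xs : List A) (f : A → ℕ) → ∑ xs f ≡ ∑ (allFin (length xs)) (f ∘ lookup xs)
∑-lookup []       f = refl
∑-lookup (x ∷ xs) f = trans (cong (f x +_) (∑-lookup xs f))
                           (sym (∑-allFin-suc (length xs) (f ∘ lookup (x ∷ xs))))

∑-allFin-indicator : ∀ n (j : Fin n) → ∑ (allFin n) (λ i → ι ⌊ i ≟ j ⌋) ≡ 1
∑-allFin-indicator (suc n) zero    = trans (∑-allFin-suc n (λ i → ι ⌊ i ≟ zero ⌋)) (cong suc (∑-zero (allFin n)))
∑-allFin-indicator (suc n) (suc j) = trans (∑-allFin-suc n (λ i → ι ⌊ i ≟ suc j ⌋)) (trans (∑-cong (allFin n) ι-suc≟suc) (∑-allFin-indicator n j))
  where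
  ι-suc≟suc : ∀ i → ι ⌊ suc i ≟ suc j ⌋ ≡ ι ⌊ i ≟ j ⌋
  ι-suc≟suc i with i ≟ j
  ... | yes _ = refl
  ... | no  _ = refl

multiplicity : DecidableEquality A → List A → A → ℕ
multiplicity _≟ᴬ_ xs a = ∑ xs (λ x → ι ⌊ x ≟ᴬ a ⌋)

Enumerates : DecidableEquality A → List A → Set
Enumerates _≟ᴬ_ xs = ∀ a → multiplicity _≟ᴬ_ xs a ≡ 1

-- Double counting over the pairs (x , y) with h x = y.
∑-reindex : ∀ (_≟ᴬ_ : DecidableEquality A) (_≟ᴮ_ : DecidableEquality B) xs ys →
            Enumerates _≟ᴬ_ xs → Enumerates _≟ᴮ_ ys →
            (h : A ⤖ B) (F : B → ℕ) → ∑ xs (F ∘ Bijection.to h) ≡ ∑ ys F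
∑-reindex _≟ᴬ_ _≟ᴮ_ xs ys xs-enum ys-enum h F = begin
    ∑ xs (F ∘ to)
  ≡⟨ ∑-cong xs (λ x → sym (*-unit-weight (F (to x)) (ys-enum (to x)))) ⟩
    ∑ xs (λ x → F (to x) * multiplicity _≟ᴮ_ ys (to x))
  ≡⟨ ∑-cong xs (λ x → sym (∑-*ˡ ys (F (to x)) _)) ⟩
    ∑ xs (λ x → ∑ ys (λ y → F (to x) * ι ⌊ y ≟ᴮ to x ⌋))
  ≡⟨ ∑-cong xs (λ x → ∑-cong ys (transpose x)) ⟩
    ∑ xs (λ x → ∑ ys (λ y → F y * ι ⌊ x ≟ᴬ to⁻ y ⌋))
  ≡⟨ ∑-swap xs ys _ ⟩
    ∑ ys (λ y → ∑ xs (λ x → F y * ι ⌊ x ≟ᴬ to⁻ y ⌋))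
  ≡⟨ ∑-cong ys (λ y → ∑-*ˡ xs (F y) _) ⟩
    ∑ ys (λ y → F y * multiplicity _≟ᴬ_ xs (to⁻ y))
  ≡⟨ ∑-cong ys (λ y → *-unit-weight (F y) (xs-enum (to⁻ y))) ⟩
    ∑ ys F ∎
  where
  open ≡-Reasoning
  open Bijection h using (to; injective; surjection)
  open Surjection surjection using (to⁻; to∘to⁻)

  *-unit-weight : ∀ c {m} → m ≡ 1 → c * m ≡ c
  *-unit-weight c refl = *-identityʳ c

  transpose : ∀ x y → F (to x) * ι ⌊ y ≟ᴮ to x ⌋ ≡ F y * ι ⌊ x ≟ᴬ to⁻ y ⌋
  transpose x y with y ≟ᴮ to x | x ≟ᴬ to⁻ y
  ... | yes refl | yes _    = refl
  ... | no  _    | no  _    = trans (*-zeroʳ (F (to x))) (sym (*-zeroʳ (F y)))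
  ... | yes refl | no  x≢   = contradiction (sym (injective (to∘to⁻ (to x)))) x≢
  ... | no  y≢   | yes refl = contradiction (sym (to∘to⁻ y)) y≢

cutTerm : ∀ {n} → VSet n → Fin n × Fin n → ℕ
cutTerm X (u , v) = ι (X u xor X v)

extend : ∀ {k} → Fin (suc k) → Bool → VSet k → VSet (suc k)
extend t β Y u = maybe Y β (dropV t u)

extend-self : ∀ {k} (t : Fin (suc k)) β (Y : VSet k) → extend t β Y t ≡ β
extend-self t β Y with t ≟ t
... | yes _   = refl
... | no t≢t = contradiction refl t≢t

extend-punchIn : ∀ {k} (t : Fin (suc k)) β (Y : VSet k) j → extend t β Y (punchIn t j) ≡ Y j
extend-punchIn t β Y j with t ≟ punchIn t j
... | yes t≡t′ = contradiction (sym t≡t′) (punchInᵢ≢i t j)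
... | no  _    = cong Y (trans (punchOut-cong t refl) (punchOut-punchIn t))

cutSize-extend : ∀ {k m} (G : Graph (suc k)) (t : Fin (suc k)) (f : Fin k → Fin m) (Z : VSet m) β →
  cutSize G (extend t β (Z ∘ f))
    ≡ cutSize (mapMaybe (keepEdge t f) G) Z + count (λ e → β xor Z (f (otherEndBd G t e))) (bdList G t)
cutSize-extend G t f Z β = begin
    ∑ G (cutTerm Y)
  ≡⟨ ∑-lookup G (cutTerm Y) ⟩
    ∑ (allFin _) (cutTerm Y ∘ lookup G)
  ≡⟨ ∑-cong (allFin _) split ⟩
    ∑ (allFin _) (λ e → kept (lookup G e) + boundary e)
  ≡⟨ ∑-+ (allFin _) (kept ∘ lookup G) boundary ⟩
    ∑ (allFin _) (kept ∘ lookup G) + ∑ (allFin _) boundary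
  ≡⟨ cong₂ _+_ (trans (sym (∑-lookup G kept)) (sym (∑-mapMaybe G (keepEdge t f) (cutTerm Z))))
               (sym (∑-mapMaybe (allFin _) (bdElem G t) _)) ⟩
    cutSize (mapMaybe (keepEdge t f) G) Z + count (λ e → β xor Z (f (otherEndBd G t e))) (bdList G t) ∎
  where
  open ≡-Reasoning
  Y : VSet _
  Y = extend t β (Z ∘ f)
  kept : Fin _ × Fin _ → ℕ
  kept = maybe (cutTerm Z) 0 ∘ keepEdge t f
  boundary : Edge G → ℕ
  boundary = maybe (λ b → ι (β xor Z (f (otherEndBd G t b)))) 0 ∘ bdElem G t
  split-∂ : ∀ ((u , v) : Fin _ × Fin _) (p : T (isBd t u v)) →
            cutTerm Y (u , v) ≡ kept (u , v) + ι (β xor Z (f (otherEnd t u v p)))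
  split-∂ (u , v) p with t ≟ u | t ≟ v
  split-∂ (u , v) () | yes _ | yes _
  ... | yes _ | no  _ = refl
  ... | no  _ | yes _ = cong ι (xor-comm (Z (f _)) β)
  split-∂ (u , v) () | no  _ | no  _

  split-∉∂ : ∀ ((u , v) : Fin _ × Fin _) → ¬ T (isBd t u v) → cutTerm Y (u , v) ≡ kept (u , v) + 0
  split-∉∂ (u , v) ¬p with t ≟ u | t ≟ v
  ... | yes _ | yes _ = cong ι (xor-same β)
  ... | yes _ | no  _ = contradiction _ ¬p
  ... | no  _ | yes _ = contradiction _ ¬p
  ... | no  _ | no  _ = sym (+-identityʳ _)

  split : ∀ e → cutTerm Y (lookup G e) ≡ kept (lookup G e) + boundary e
  split e with T? (isBd t (proj₁ (ends G e)) (proj₂ (ends G e)))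
  ... | yes p  = split-∂ (ends G e) p
  ... | no  ¬p = split-∉∂ (ends G e) ¬p

Separates : ∀ {n} → VSet n → Fin n → Fin n → Set
Separates Y u w = T (Y u xor Y w)

separates : ∀ {n} {Y : VSet n} {u w} → T (Y u) → T (not (Y w)) → Separates Y u w
separates {Y = Y} {u} {w} _ _ with Y u | Y w
separates _  _  | true  | false = _
separates () _  | false | _
separates _  () | true  | true

separates-sym : ∀ {n} {Y : VSet n} {u w} → Separates Y u w → Separates Y w u
separates-sym {Y = Y} {u} {w} = subst T (xor-comm (Y u) (Y w))

T-not-xor-self : ∀ x → T (not x xor x)
T-not-xor-self false = _
T-not-xor-self true  = _

extend-separates-punchIn : ∀ {k} (t : Fin (suc k)) β {Y : VSet k} {i j} →
                           Separates Y i j → Separates (extend t β Y) (punchIn t i) (punchIn t j)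
extend-separates-punchIn t β {Y} {i} {j} =
  subst T (sym (cong₂ _xor_ (extend-punchIn t β Y i) (extend-punchIn t β Y j)))

extend-separates-self : ∀ {k} (t : Fin (suc k)) β {Y : VSet k} {j} →
                        T (β xor Y j) → Separates (extend t β Y) t (punchIn t j)
extend-separates-self t β {Y} {j} =
  subst T (sym (cong₂ _xor_ (extend-self t β Y) (extend-punchIn t β Y j)))

cutSize-complement : ∀ {n} (G : Graph n) (Y : VSet n) → cutSize G (not ∘ Y) ≡ cutSize G Y
cutSize-complement G Y = ∑-cong G (λ (u , v) → cong ι (not-xor-not (Y u) (Y v)))
  where
  not-xor-not : ∀ x y → not x xor not y ≡ x xor y
  not-xor-not false y = not-involutive y
  not-xor-not true  y = refl

separating-cut : ∀ {n d} {G : Graph n} {Tm : VSet n} {u w} (Y : VSet n) →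
                 EdgeConnected d G Tm → T (Tm u) → T (Tm w) → Separates Y u w → d ≤ cutSize G Y
separating-cut {d = d} {G} {u = u} {w} Y ec u∈T w∈T sep with Y u in Yu | Y w in Yw
... | true  | false = ec Y u w u∈T w∈T (subst T (sym Yu) _) (subst (T ∘ not) (sym Yw) _)
... | false | true  = subst (d ≤_) (cutSize-complement G Y)
                        (ec (not ∘ Y) u w u∈T w∈T (subst (T ∘ not) (sym Yu) _) (subst (T ∘ not ∘ not) (sym Yw) _))

⁅_⁆ : ∀ {k} → Fin (suc k) → VSet (suc k)
⁅ t ⁆ = extend t true (λ _ → false)

⁅⁆-eqb : ∀ {k} (t u : Fin (suc k)) → ⁅ t ⁆ u ≡ eqb u t
⁅⁆-eqb t u with t ≟ u | u ≟ t
... | yes _   | yes _   = refl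
... | no  _   | no  _   = refl
... | yes t≡u | no  u≢t = contradiction (sym t≡u) u≢t
... | no  t≢u | yes u≡t = contradiction (sym u≡t) t≢u

cutSize-⁅⁆ : ∀ {k} (G : Graph (suc k)) (t : Fin (suc k)) → cutSize G ⁅ t ⁆ ≡ length (bdList G t)
cutSize-⁅⁆ G t = trans (cutSize-extend G t id (λ _ → false) true)
                       (cong₂ _+_ (∑-zero (mapMaybe (keepEdge t id) G)) (∑-one (bdList G t)))

cutSize-⁅⁆≤degree : ∀ {k} (G : Graph (suc k)) (t : Fin (suc k)) → cutSize G ⁅ t ⁆ ≤ degree G t
cutSize-⁅⁆≤degree G t = ∑-mono G λ (u , v) →
  ≤-trans (≤-reflexive (cong ι (cong₂ _xor_ (⁅⁆-eqb t u) (⁅⁆-eqb t v)))) (ι-xor≤ (eqb u t) (eqb v t))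
  where
  ι-xor≤ : ∀ x y → ι (x xor y) ≤ ι x + ι y
  ι-xor≤ false y     = ≤-refl
  ι-xor≤ true  false = ≤-refl
  ι-xor≤ true  true  = z≤n

length-bdList≡d : ∀ {k d} (G : Graph (suc k)) (Tm : VSet (suc k)) {t j} →
                EdgeConnected d G Tm → T (Tm t) → T (Tm (punchIn t j)) → degree G t ≡ d →
                length (bdList G t) ≡ d
length-bdList≡d G Tm {t} ec t∈T r∈T deg≡d = ≤-antisym
  (≤-trans (≤-reflexive (sym (cutSize-⁅⁆ G t))) (≤-trans (cutSize-⁅⁆≤degree G t) (≤-reflexive deg≡d)))
  (≤-trans (separating-cut {G = G} ⁅ t ⁆ ec t∈T r∈T (extend-separates-self t true _)) (≤-reflexive (cutSize-⁅⁆ G t)))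

otherTerminal : ∀ {k} (Tm : VSet (suc k)) (t : Fin (suc k)) → 2 ≤ card Tm → ∃ λ j → T (Tm (punchIn t j))
otherTerminal Tm t 2≤card with any? (λ j → T? (Tm (punchIn t j)))
... | yes found = found
... | no  none  = contradiction (≤-trans 2≤card card≤1) λ { (s≤s ()) }
  where
  only-t : ∀ i → ι (Tm i) ≤ ι ⌊ i ≟ t ⌋
  only-t i with i ≟ t | Tm i in Tm-i
  ... | yes _   | true  = ≤-refl
  ... | _       | false = z≤n
  ... | no  i≢t | true  =
    contradiction (punchOut (i≢t ∘ sym) , subst T (sym (trans (cong Tm (punchIn-punchOut _)) Tm-i)) _) none
  card≤1 : card Tm ≤ 1
  card≤1 = ≤-trans (∑-mono (allFin _) only-t) (≤-reflexive (∑-allFin-indicator _ t))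

Bd-≟ : ∀ {n} (G : Graph n) (t : Fin n) → DecidableEquality (Bd G t)
Bd-≟ G t (e , p) (e′ , p′) with e ≟ e′
... | yes refl = yes (cong (e ,_) (T-irrelevant p p′))
... | no  e≢e′ = no (e≢e′ ∘ cong proj₁)

bdList-enumerates : ∀ {n} (G : Graph n) (t : Fin n) → Enumerates (Bd-≟ G t) (bdList G t)
bdList-enumerates G t (e′ , p′) =
  trans (∑-mapMaybe (allFin _) (bdElem G t) _) (trans (∑-cong (allFin _) at) (∑-allFin-indicator _ e′))
  where
  at : ∀ e → maybe (λ b → ι ⌊ Bd-≟ G t b (e′ , p′) ⌋) 0 (bdElem G t e) ≡ ι ⌊ e ≟ e′ ⌋
  at e with T? (isBd t (proj₁ (ends G e)) (proj₂ (ends G e)))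
  ... | yes _  with e ≟ e′
  ...   | yes refl = refl
  ...   | no  _    = refl
  at e | no ¬p with e ≟ e′
  ...   | yes refl = contradiction p′ ¬p
  ...   | no  _    = refl

module CrossingCounts {E : Set} (L : List E) (a b : E → Bool) where

  mismatches : (E → Bool) → Bool → ℕ
  mismatches f β = count (λ e → β xor f e) L

  M₁ M₂ : Bool → ℕ
  M₁ = mismatches a
  M₂ = mismatches b

  C : ℕ
  C = count (λ e → a e xor b e) L

  private
    count-≤-+ : ∀ {p q r : E → Bool} → (∀ e → ι (p e) ≤ ι (q e) + ι (r e)) → count p L ≤ count q L + count r L
    count-≤-+ {p} {q} {r} pqr = ≤-trans (∑-mono L pqr) (≤-reflexive (∑-+ L (ι ∘ q) (ι ∘ r)))

    ι-xor-triangle : ∀ x y z → ι (x xor z) ≤ ι (x xor y) + ι (y xor z)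
    ι-xor-triangle false false z     = ≤-refl
    ι-xor-triangle false true  false = z≤n
    ι-xor-triangle false true  true  = s≤s z≤n
    ι-xor-triangle true  false false = s≤s z≤n
    ι-xor-triangle true  false true  = z≤n
    ι-xor-triangle true  true  z     = ≤-refl

  M₁≤M₂+C : ∀ β → M₁ β ≤ M₂ β + C
  M₁≤M₂+C β = ≤-trans (count-≤-+ (λ e → ι-xor-triangle β (b e) (a e)))
                      (≤-reflexive (cong (M₂ β +_) (∑-cong L (λ e → cong ι (xor-comm (b e) (a e))))))

  M₂≤M₁+C : ∀ β → M₂ β ≤ M₁ β + C
  M₂≤M₁+C β = count-≤-+ (λ e → ι-xor-triangle β (a e) (b e))

  mismatches-complement : ∀ f β → mismatches f β + mismatches f (not β) ≡ length L
  mismatches-complement f β = begin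
      mismatches f β + mismatches f (not β)          ≡⟨ ∑-+ L _ _ ⟨
      ∑ L (λ e → ι (β xor f e) + ι (not β xor f e)) ≡⟨ ∑-cong L (λ e → exactly-one β (f e)) ⟩
      ∑ L (λ _ → 1)                                 ≡⟨ ∑-one L ⟩
      length L                                      ∎
    where
    open ≡-Reasoning
    exactly-one : ∀ β′ x → ι (β′ xor x) + ι (not β′ xor x) ≡ 1
    exactly-one false false = refl
    exactly-one false true  = refl
    exactly-one true  false = refl
    exactly-one true  true  = refl

  length≤M₁+M₂+C : ∀ β → length L ≤ M₁ β + (M₂ (not β) + C)
  length≤M₁+M₂+C β = begin
      length L                                                          ≡⟨ ∑-one L ⟨
      ∑ L (λ _ → 1)                                                     ≤⟨ ∑-mono L (λ e → cover β (a e) (b e)) ⟩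
      ∑ L (λ e → ι (β xor a e) + (ι (not β xor b e) + ι (a e xor b e))) ≡⟨ ∑-+ L _ _ ⟩
      M₁ β + ∑ L (λ e → ι (not β xor b e) + ι (a e xor b e))            ≡⟨ cong (M₁ β +_) (∑-+ L _ _) ⟩
      M₁ β + (M₂ (not β) + C)                                           ∎
    where
    open ≤-Reasoning
    cover : ∀ β′ x y → 1 ≤ ι (β′ xor x) + (ι (not β′ xor y) + ι (x xor y))
    cover false false false = s≤s z≤n
    cover false false true  = s≤s z≤n
    cover false true  false = s≤s z≤n
    cover false true  true  = s≤s z≤n
    cover true  false false = s≤s z≤n
    cover true  false true  = s≤s z≤n
    cover true  true  false = s≤s z≤n
    cover true  true  true  = s≤s z≤n

  module _ {d c₁ c₂ : ℕ} (∣L∣≡d : length L ≡ d) where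

    private
      ≤-by-complement : ∀ {x y c} → x + y ≡ length L → d ≤ c + y → x ≤ c
      ≤-by-complement {x} {y} {c} x+y≡∣L∣ d≤c+y =
        +-cancelʳ-≤ y x c (≤-trans (≤-reflexive (trans x+y≡∣L∣ ∣L∣≡d)) d≤c+y)

    cut-bound-same₁ : ∀ ρ → d ≤ c₁ + M₁ ρ → d ≤ c₂ + M₂ (not ρ) → d ≤ c₁ + (c₂ + C)
    cut-bound-same₁ ρ h₁ h₂ = begin
        d               ≤⟨ h₁ ⟩
        c₁ + M₁ ρ       ≤⟨ +-monoʳ-≤ c₁ (M₁≤M₂+C ρ) ⟩
        c₁ + (M₂ ρ + C) ≤⟨ +-monoʳ-≤ c₁ (+-monoˡ-≤ C (≤-by-complement (mismatches-complement b ρ) h₂)) ⟩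
        c₁ + (c₂ + C)   ∎
      where open ≤-Reasoning

    cut-bound-same₂ : ∀ ρ → d ≤ c₁ + M₁ (not ρ) → d ≤ c₂ + M₂ ρ → d ≤ c₁ + (c₂ + C)
    cut-bound-same₂ ρ h₁ h₂ = begin
        d               ≤⟨ h₂ ⟩
        c₂ + M₂ ρ       ≤⟨ +-monoʳ-≤ c₂ (M₂≤M₁+C ρ) ⟩
        c₂ + (M₁ ρ + C) ≤⟨ +-monoʳ-≤ c₂ (+-monoˡ-≤ C (≤-by-complement (mismatches-complement a ρ) h₁)) ⟩
        c₂ + (c₁ + C)   ≡⟨ x∙yz≈y∙xz +-commutativeSemigroup c₂ c₁ C ⟩
        c₁ + (c₂ + C)   ∎
      where open ≤-Reasoning

    cut-bound-cross : ∀ β → d ≤ c₁ + M₁ (not β) → d ≤ c₂ + M₂ β → d ≤ c₁ + (c₂ + C)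
    cut-bound-cross β h₁ h₂ = begin
        d                       ≡⟨ ∣L∣≡d ⟨
        length L                ≤⟨ length≤M₁+M₂+C β ⟩
        M₁ β + (M₂ (not β) + C) ≤⟨ +-mono-≤ M₁β≤c₁ (+-monoˡ-≤ C M₂¬β≤c₂) ⟩
        c₁ + (c₂ + C)           ∎
      where
      open ≤-Reasoning
      M₁β≤c₁ : M₁ β ≤ c₁
      M₁β≤c₁ = ≤-by-complement (mismatches-complement a β) h₁
      M₂¬β≤c₂ : M₂ (not β) ≤ c₂
      M₂¬β≤c₂ = ≤-by-complement (trans (+-comm (M₂ (not β)) (M₂ β)) (mismatches-complement b β)) h₂

data SplitAt (m n : ℕ) : Fin (m + n) → Set where
  inˡ : ∀ i → SplitAt m n (i ↑ˡ n)
  inʳ : ∀ j → SplitAt m n (m ↑ʳ j)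

splitAt-view : ∀ m n x → SplitAt m n x
splitAt-view m n x with splitAt m x in eq
... | inj₁ i = subst (SplitAt m n) (splitAt⁻¹-↑ˡ eq) (inˡ i)
... | inj₂ j = subst (SplitAt m n) (splitAt⁻¹-↑ʳ eq) (inʳ j)

insertT-↑ˡ : ∀ {k₁ k₂} (T₁ : VSet (suc k₁)) (T₂ : VSet (suc k₂)) t₁ t₂ i →
             insertT T₁ T₂ t₁ t₂ (i ↑ˡ k₂) ≡ T₁ (punchIn t₁ i)
insertT-↑ˡ {k₁} {k₂} T₁ T₂ t₁ t₂ i = cong [ T₁ ∘ punchIn t₁ , T₂ ∘ punchIn t₂ ] (splitAt-↑ˡ k₁ i k₂)

insertT-↑ʳ : ∀ {k₁ k₂} (T₁ : VSet (suc k₁)) (T₂ : VSet (suc k₂)) t₁ t₂ j →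
             insertT T₁ T₂ t₁ t₂ (k₁ ↑ʳ j) ≡ T₂ (punchIn t₂ j)
insertT-↑ʳ {k₁} {k₂} T₁ T₂ t₁ t₂ j = cong [ T₁ ∘ punchIn t₁ , T₂ ∘ punchIn t₂ ] (splitAt-↑ʳ k₁ k₂ j)

module Insertion {k₁ k₂} (G₁ : Graph (suc k₁)) (G₂ : Graph (suc k₂)) (t₁ : Fin (suc k₁)) (t₂ : Fin (suc k₂))
                 (h : Bd G₁ t₁ ⤖ Bd G₂ t₂) (X : VSet (k₁ + k₂)) where

  open Bijection h using (to)

  X₁ : VSet k₁
  X₁ = X ∘ (_↑ˡ k₂)

  X₂ : VSet k₂
  X₂ = X ∘ (k₁ ↑ʳ_)

  -- The sides of X containing the two ends of the edge of G that replaces e ∈ ∂(t₁).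
  a b : Bd G₁ t₁ → Bool
  a e = X₁ (otherEndBd G₁ t₁ e)
  b e = X₂ (otherEndBd G₂ t₂ (to e))

  c₁ c₂ : ℕ
  c₁ = cutSize (mapMaybe (keepEdge t₁ (_↑ˡ k₂)) G₁) X
  c₂ = cutSize (mapMaybe (keepEdge t₂ (k₁ ↑ʳ_)) G₂) X

  open CrossingCounts (bdList G₁ t₁) a b public

  cutSize-insertG : cutSize (insertG G₁ G₂ t₁ t₂ to) X ≡ c₁ + (c₂ + C)
  cutSize-insertG =
    trans (∑-++ (mapMaybe (keepEdge t₁ (_↑ˡ k₂)) G₁) _ _)
      (cong (c₁ +_) (trans (∑-++ (mapMaybe (keepEdge t₂ (k₁ ↑ʳ_)) G₂) _ _)
        (cong (c₂ +_) (∑-map (bdList G₁ t₁) _ _))))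

  cutSize-extend₁ : ∀ β → cutSize G₁ (extend t₁ β X₁) ≡ c₁ + M₁ β
  cutSize-extend₁ = cutSize-extend G₁ t₁ (_↑ˡ k₂) X

  cutSize-extend₂ : ∀ β → cutSize G₂ (extend t₂ β X₂) ≡ c₂ + M₂ β
  cutSize-extend₂ β = trans (cutSize-extend G₂ t₂ (k₁ ↑ʳ_) X β) (cong (c₂ +_) (sym
    (∑-reindex (Bd-≟ G₁ t₁) (Bd-≟ G₂ t₂) (bdList G₁ t₁) (bdList G₂ t₂) (bdList-enumerates G₁ t₁) (bdList-enumerates G₂ t₂) h
       (λ y → ι (β xor X₂ (otherEndBd G₂ t₂ y))))))

module InsertionCut {k₁ k₂} (G₁ : Graph (suc k₁)) (T₁ : VSet (suc k₁)) (G₂ : Graph (suc k₂)) (T₂ : VSet (suc k₂))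
  {d : ℕ} (ec₁ : EdgeConnected d G₁ T₁) (ec₂ : EdgeConnected d G₂ T₂)
  {t₁ t₂ j₁ j₂} (t₁∈T₁ : T (T₁ t₁)) (t₂∈T₂ : T (T₂ t₂)) (r₁∈T₁ : T (T₁ (punchIn t₁ j₁))) (r₂∈T₂ : T (T₂ (punchIn t₂ j₂)))
  (h : Bd G₁ t₁ ⤖ Bd G₂ t₂) (∣∂t₁∣≡d : length (bdList G₁ t₁) ≡ d) (X : VSet (k₁ + k₂)) where

  open Insertion G₁ G₂ t₁ t₂ h X

  private
    cut₁ : ∀ β {u w} → T (T₁ u) → T (T₁ w) → Separates (extend t₁ β X₁) u w → d ≤ c₁ + M₁ β
    cut₁ β u∈T w∈T sep = subst (d ≤_) (cutSize-extend₁ β) (separating-cut {G = G₁} (extend t₁ β X₁) ec₁ u∈T w∈T sep)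

    cut₂ : ∀ β {u w} → T (T₂ u) → T (T₂ w) → Separates (extend t₂ β X₂) u w → d ≤ c₂ + M₂ β
    cut₂ β u∈T w∈T sep = subst (d ≤_) (cutSize-extend₂ β) (separating-cut {G = G₂} (extend t₂ β X₂) ec₂ u∈T w∈T sep)

    Tm : VSet (k₁ + k₂)
    Tm = insertT T₁ T₂ t₁ t₂

    ↑ˡ∈T₁ : ∀ {i} → T (Tm (i ↑ˡ k₂)) → T (T₁ (punchIn t₁ i))
    ↑ˡ∈T₁ {i} = subst T (insertT-↑ˡ T₁ T₂ t₁ t₂ i)

    ↑ʳ∈T₂ : ∀ {j} → T (Tm (k₁ ↑ʳ j)) → T (T₂ (punchIn t₂ j))
    ↑ʳ∈T₂ {j} = subst T (insertT-↑ʳ T₁ T₂ t₁ t₂ j)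

    cross : ∀ i j → T (T₁ (punchIn t₁ i)) → T (T₂ (punchIn t₂ j)) → Separates X (i ↑ˡ k₂) (k₁ ↑ʳ j) →
            d ≤ c₁ + (c₂ + C)
    cross i j i∈T₁ j∈T₂ sep = cut-bound-cross ∣∂t₁∣≡d (X₁ i)
      (cut₁ (not (X₁ i)) t₁∈T₁ i∈T₁ (extend-separates-self t₁ _ (T-not-xor-self (X₁ i))))
      (cut₂ (X₁ i) t₂∈T₂ j∈T₂ (extend-separates-self t₂ _ sep))

    bound : ∀ {s t} → SplitAt k₁ k₂ s → SplitAt k₁ k₂ t → T (Tm s) → T (Tm t) → Separates X s t →
            d ≤ c₁ + (c₂ + C)
    bound (inˡ i) (inˡ j) s∈T t∈T sep = cut-bound-same₁ ∣∂t₁∣≡d (X₂ j₂)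
      (cut₁ (X₂ j₂) (↑ˡ∈T₁ s∈T) (↑ˡ∈T₁ t∈T) (extend-separates-punchIn t₁ _ sep))
      (cut₂ (not (X₂ j₂)) t₂∈T₂ r₂∈T₂ (extend-separates-self t₂ _ (T-not-xor-self (X₂ j₂))))
    bound (inʳ i) (inʳ j) s∈T t∈T sep = cut-bound-same₂ ∣∂t₁∣≡d (X₁ j₁)
      (cut₁ (not (X₁ j₁)) t₁∈T₁ r₁∈T₁ (extend-separates-self t₁ _ (T-not-xor-self (X₁ j₁))))
      (cut₂ (X₁ j₁) (↑ʳ∈T₂ s∈T) (↑ʳ∈T₂ t∈T) (extend-separates-punchIn t₂ _ sep))
    bound (inˡ i) (inʳ j) s∈T t∈T sep = cross i j (↑ˡ∈T₁ s∈T) (↑ʳ∈T₂ t∈T) sep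
    bound (inʳ i) (inˡ j) s∈T t∈T sep = cross j i (↑ˡ∈T₁ t∈T) (↑ʳ∈T₂ s∈T) (separates-sym {Y = X} sep)

  insertG-separating-cut : ∀ {s t} → T (Tm s) → T (Tm t) → Separates X s t →
                           d ≤ cutSize (insertG G₁ G₂ t₁ t₂ (Bijection.to h)) X
  insertG-separating-cut {s} {t} s∈T t∈T sep =
    subst (d ≤_) (sym cutSize-insertG) (bound (splitAt-view k₁ k₂ s) (splitAt-view k₁ k₂ t) s∈T t∈T sep)

lemma2p1 : ∀ {k₁ k₂ : ℕ} (G₁ : Graph (suc k₁)) (T₁ : VSet (suc k₁))
             (G₂ : Graph (suc k₂)) (T₂ : VSet (suc k₂)) (d : ℕ) → 1 ≤ d →
           2 ≤ card T₁ → EdgeConnected d G₁ T₁ →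
           2 ≤ card T₂ → EdgeConnected d G₂ T₂ →
           (t₁ : Fin (suc k₁)) → T (T₁ t₁) → degree G₁ t₁ ≡ d →
           (t₂ : Fin (suc k₂)) → T (T₂ t₂) → degree G₂ t₂ ≡ d →
           (h : Bd G₁ t₁ ⤖ Bd G₂ t₂) →
           EdgeConnected d (insertG G₁ G₂ t₁ t₂ (Bijection.to h)) (insertT T₁ T₂ t₁ t₂)
lemma2p1 G₁ T₁ G₂ T₂ d _ 2≤∣T₁∣ ec₁ 2≤∣T₂∣ ec₂ t₁ t₁∈T₁ deg-t₁≡d t₂ t₂∈T₂ _ h X s t s∈T t∈T s∈X t∉X
  with otherTerminal T₁ t₁ 2≤∣T₁∣ | otherTerminal T₂ t₂ 2≤∣T₂∣
... | _ , r₁∈T₁ | _ , r₂∈T₂ = insertG-separating-cut s∈T t∈T (separates {Y = X} s∈X t∉X)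
  where
  open InsertionCut G₁ T₁ G₂ T₂ ec₁ ec₂ t₁∈T₁ t₂∈T₂ r₁∈T₁ r₂∈T₂ h (length-bdList≡d G₁ T₁ ec₁ t₁∈T₁ r₁∈T₁ deg-t₁≡d) X
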